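{- For all $e,f\in\mathbb{E}$ and all formulas $\phi,\psi\in\mathbb{F}$: $e^{\bot\top}\equiv e^{\bot}$; $\mathtt{1}^{\bot}\equiv\mathtt{0}$; $\mathtt{0}^{\bot}\equiv\mathtt{1}$; $(e+f)^{\top}\equiv e^{\top}+f^{\top}$; $(e^{\top}\cdot f)^{\top}\equiv e^{\top}\cdot f^{\top}$; $e^{\top}\cdot e\equiv e$; $(e^*)^{\top}\equiv\mathtt{1}$; $e\cdot f^{\top}\equiv\mathtt{0}\iff e\cdot f\equiv\mathtt{0}$; $\phi\cdot\phi^{\bot}\equiv\mathtt{0}$; $\phi+\phi^{\bot}\equiv\mathtt{1}$; $\phi^{\bot\bot}\equiv\phi$; $\phi\cdot e\equiv\mathtt{0}\iff\phi\leqq e^{\bot}$; $\phi\cdot\phi\equiv\phi$; $\phi\cdot\psi\equiv\psi\cdot\phi$; $\phi^{\top}\equiv\phi$; if $(e\cdot\phi)^{\top}\leqq\phi$ then $(e^*\cdot\phi)^{\top}\leqq\phi$; if $\phi\leqq(e\cdot\phi^{\bot})^{\bot}$ then $\phi\leqq(e^*\cdot\phi^{\bot})^{\bot}$.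
   Context: Fix disjoint countably infinite sets $\Sigma$ (actions) and $\Pi$ (propositional letters). The set $\mathbb{E}$ of expressions is generated by $e,f::=\mathtt{a}\in\Sigma\mid \mathtt{p}\in\Pi\mid \mathtt{0}\mid\mathtt{1}\mid e+f\mid e\cdot f\mid e^{\bot}\mid e^{\top}\mid e^{*}$. The set $\mathbb{F}$ of formulas is generated by $\phi,\psi::=\mathtt{p}\in\Pi\mid\mathtt{0}\mid\mathtt{1}\mid\phi+\psi\mid\phi\cdot\psi\mid e^{\bot}\mid e^{\top}$ with $e\in\mathbb{E}$. The relation $\equiv$ is the smallest congruence on $\mathbb{E}$ (w.r.t. all operations) such that, writing $e\leqq f$ for $e+f\equiv f$, for all $e,f,g\in\mathbb{E}$, $\mathtt{p}\in\Pi$: $+$ is associative, commutative, idempotent with identity $\mathtt{0}$; $\cdot$ is associative with identity $\mathtt{1}$; $\mathtt{0}\cdot e\equiv\mathtt{0}\equiv e\cdot\mathtt{0}$; $\cdot$ distributes over $+$ on both sides; $\mathtt{1}+e\cdot e^*\leqq e^*$; $\mathtt{1}+e^*\cdot e\leqq e^*$; if $f+e\cdot g\leqq g$ then $e^*\cdot f\leqq g$; if $f+g\cdot e\leqq g$ then $f\cdot e^*\leqq g$; and $e^{\bot}\cdot e\equiv\mathtt{0}$, $(e\cdot f)^{\bot}\equiv(e\cdot f^{\top})^{\bot}$, $e^{\bot}+e^{\top}\equiv\mathtt{1}$, $\mathtt{p}^{\top}\equiv\mathtt{p}$, $e^{\top}\equiv(e^{\bot})^{\bot}$. -}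

module Defs where

open import Data.Nat using (ℕ)

-- Actions Σ and propositional letters Π: disjoint countably infinite sets,
-- represented by two separate constructors indexed by ℕ.

infixl 6 _⊕_
infixl 7 _⊙_

data Expr : Set where
  act  : ℕ → Expr
  prop : ℕ → Expr
  𝟘 𝟙  : Expr
  _⊕_  : Expr → Expr → Expr
  _⊙_  : Expr → Expr → Expr
  _⊥ᵉ  : Expr → Expr
  _⊤ᵉ  : Expr → Expr
  _⋆   : Expr → Expr

data Formula : Set where
  fprop : ℕ → Formula
  f𝟘 f𝟙 : Formula
  _f⊕_  : Formula → Formula → Formula
  _f⊙_  : Formula → Formula → Formula
  _f⊥   : Expr → Formula
  _f⊤   : Expr → Formula

⌜_⌝ : Formula → Expr
⌜ fprop p ⌝ = prop p
⌜ f𝟘 ⌝ = 𝟘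
⌜ f𝟙 ⌝ = 𝟙
⌜ φ f⊕ ψ ⌝ = ⌜ φ ⌝ ⊕ ⌜ ψ ⌝
⌜ φ f⊙ ψ ⌝ = ⌜ φ ⌝ ⊙ ⌜ ψ ⌝
⌜ e f⊥ ⌝ = e ⊥ᵉ
⌜ e f⊤ ⌝ = e ⊤ᵉ

infix 4 _≡ₑ_ _≦_

-- The smallest congruence satisfying the axioms (with e ≦ f := e + f ≡ f).
data _≡ₑ_ : Expr → Expr → Set where
  refl≡  : ∀ {e} → e ≡ₑ e
  sym≡   : ∀ {e f} → e ≡ₑ f → f ≡ₑ e
  trans≡ : ∀ {e f g} → e ≡ₑ f → f ≡ₑ g → e ≡ₑ g
  ⊕-cong : ∀ {e e′ f f′} → e ≡ₑ e′ → f ≡ₑ f′ → e ⊕ f ≡ₑ e′ ⊕ f′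
  ⊙-cong : ∀ {e e′ f f′} → e ≡ₑ e′ → f ≡ₑ f′ → e ⊙ f ≡ₑ e′ ⊙ f′
  ⊥-cong : ∀ {e e′} → e ≡ₑ e′ → e ⊥ᵉ ≡ₑ e′ ⊥ᵉ
  ⊤-cong : ∀ {e e′} → e ≡ₑ e′ → e ⊤ᵉ ≡ₑ e′ ⊤ᵉ
  ⋆-cong : ∀ {e e′} → e ≡ₑ e′ → e ⋆ ≡ₑ e′ ⋆
  ⊕-assoc : ∀ e f g → (e ⊕ f) ⊕ g ≡ₑ e ⊕ (f ⊕ g)
  ⊕-comm  : ∀ e f → e ⊕ f ≡ₑ f ⊕ e
  ⊕-idem  : ∀ e → e ⊕ e ≡ₑ e
  ⊕-idˡ   : ∀ e → 𝟘 ⊕ e ≡ₑ e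
  ⊙-assoc : ∀ e f g → (e ⊙ f) ⊙ g ≡ₑ e ⊙ (f ⊙ g)
  ⊙-idˡ   : ∀ e → 𝟙 ⊙ e ≡ₑ e
  ⊙-idʳ   : ∀ e → e ⊙ 𝟙 ≡ₑ e
  ⊙-zeroˡ : ∀ e → 𝟘 ⊙ e ≡ₑ 𝟘
  ⊙-zeroʳ : ∀ e → e ⊙ 𝟘 ≡ₑ 𝟘
  distribˡ : ∀ e f g → e ⊙ (f ⊕ g) ≡ₑ e ⊙ f ⊕ e ⊙ g
  distribʳ : ∀ e f g → (e ⊕ f) ⊙ g ≡ₑ e ⊙ g ⊕ f ⊙ g
  ⋆-unfoldˡ : ∀ e → (𝟙 ⊕ e ⊙ e ⋆) ⊕ e ⋆ ≡ₑ e ⋆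
  ⋆-unfoldʳ : ∀ e → (𝟙 ⊕ e ⋆ ⊙ e) ⊕ e ⋆ ≡ₑ e ⋆
  ⋆-indˡ : ∀ {e f g} → (f ⊕ e ⊙ g) ⊕ g ≡ₑ g → e ⋆ ⊙ f ⊕ g ≡ₑ g
  ⋆-indʳ : ∀ {e f g} → (f ⊕ g ⊙ e) ⊕ g ≡ₑ g → f ⊙ e ⋆ ⊕ g ≡ₑ g
  ⊥-ann   : ∀ e → e ⊥ᵉ ⊙ e ≡ₑ 𝟘
  ⊥-loc   : ∀ e f → (e ⊙ f) ⊥ᵉ ≡ₑ (e ⊙ f ⊤ᵉ) ⊥ᵉ
  ⊥⊤-compl : ∀ e → e ⊥ᵉ ⊕ e ⊤ᵉ ≡ₑ 𝟙
  prop-⊤  : ∀ p → (prop p) ⊤ᵉ ≡ₑ prop p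
  ⊤-def   : ∀ e → e ⊤ᵉ ≡ₑ (e ⊥ᵉ) ⊥ᵉ

_≦_ : Expr → Expr → Set
e ≦ f = e ⊕ f ≡ₑ f

-- The elements e ⊥ᵉ ("tests") form a Boolean algebra of subidentities: every
-- test p has complement p ⊥ᵉ (p ⊕ p ⊥ᵉ ≈ 𝟙, p ⊙ p ⊥ᵉ ≈ 𝟘), so tests are
-- idempotent, commute with all subidentities and satisfy the Galois connection
-- p ⊙ e ≈ 𝟘 ⇔ p ≦ e ⊥ᵉ. Every formula denotes a test, which yields the laws
-- for formulas. The two star laws reduce to star induction: if e cannot leave
-- a test t (t ⊥ᵉ ⊙ (e ⊙ t) ≈ 𝟘), then t ⊙ (e ⋆ ⊙ t) contains t and is closed
-- under left multiplication by e, hence contains e ⋆ ⊙ t.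
module Submission where

open import Defs
open import Data.Product using (_×_; _,_; ∃)
open import Function.Bundles using (_⇔_; mk⇔; Equivalence)
open import Level using (0ℓ)
open import Relation.Binary.Bundles using (Poset)
open import Relation.Binary.Structures using (IsEquivalence; IsPartialOrder)
import Relation.Binary.Reasoning.PartialOrder as PartialOrderReasoning

≡ₑ-isEquivalence : IsEquivalence _≡ₑ_
≡ₑ-isEquivalence = record { refl = refl≡ ; sym = sym≡ ; trans = trans≡ }

≦-refl : ∀ {e} → e ≦ e
≦-refl {e} = ⊕-idem e

≈⇒≦ : ∀ {e f} → e ≡ₑ f → e ≦ f
≈⇒≦ e≈f = trans≡ (⊕-cong e≈f refl≡) ≦-refl

≦-trans : ∀ {e f g} → e ≦ f → f ≦ g → e ≦ g
≦-trans {e} {f} {g} e≦f f≦g =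
  trans≡ (⊕-cong refl≡ (sym≡ f≦g))
    (trans≡ (sym≡ (⊕-assoc e f g)) (trans≡ (⊕-cong e≦f refl≡) f≦g))

≦-antisym : ∀ {e f} → e ≦ f → f ≦ e → e ≡ₑ f
≦-antisym {e} {f} e≦f f≦e = trans≡ (sym≡ f≦e) (trans≡ (⊕-comm f e) e≦f)

≦-isPartialOrder : IsPartialOrder _≡ₑ_ _≦_
≦-isPartialOrder = record
  { isPreorder = record
    { isEquivalence = ≡ₑ-isEquivalence
    ; reflexive     = ≈⇒≦
    ; trans         = ≦-trans
    }
  ; antisym = ≦-antisym
  }

≦-poset : Poset 0ℓ 0ℓ 0ℓ
≦-poset = record { isPartialOrder = ≦-isPartialOrder }

open PartialOrderReasoning ≦-poset

⊕-identityʳ : ∀ e → e ⊕ 𝟘 ≡ₑ e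
⊕-identityʳ e = trans≡ (⊕-comm e 𝟘) (⊕-idˡ e)

e≦e⊕f : ∀ e f → e ≦ e ⊕ f
e≦e⊕f e f = trans≡ (sym≡ (⊕-assoc e e f)) (⊕-cong (⊕-idem e) refl≡)

f≦e⊕f : ∀ e f → f ≦ e ⊕ f
f≦e⊕f e f = ≦-trans (e≦e⊕f f e) (≈⇒≦ (⊕-comm f e))

⊕-lub : ∀ {e f g} → e ≦ g → f ≦ g → e ⊕ f ≦ g
⊕-lub {e} {f} {g} e≦g f≦g = trans≡ (⊕-assoc e f g) (trans≡ (⊕-cong refl≡ f≦g) e≦g)

⊕-monoʳ : ∀ {e f} g → e ≦ f → g ⊕ e ≦ g ⊕ f
⊕-monoʳ {e} {f} g e≦f = ⊕-lub (e≦e⊕f g f) (≦-trans e≦f (f≦e⊕f g f))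

⊙-monoˡ : ∀ {e f} g → e ≦ f → e ⊙ g ≦ f ⊙ g
⊙-monoˡ {e} {f} g e≦f = trans≡ (sym≡ (distribʳ e f g)) (⊙-cong e≦f refl≡)

⊙-monoʳ : ∀ {e f} g → e ≦ f → g ⊙ e ≦ g ⊙ f
⊙-monoʳ {e} {f} g e≦f = trans≡ (sym≡ (distribˡ g e f)) (⊙-cong refl≡ e≦f)

⊙-mono : ∀ {e e′ f f′} → e ≦ e′ → f ≦ f′ → e ⊙ f ≦ e′ ⊙ f′
⊙-mono {e′ = e′} {f = f} e≦e′ f≦f′ = ≦-trans (⊙-monoˡ f e≦e′) (⊙-monoʳ e′ f≦f′)

≦𝟘⇒≈𝟘 : ∀ {e} → e ≦ 𝟘 → e ≡ₑ 𝟘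
≦𝟘⇒≈𝟘 {e} e≦𝟘 = trans≡ (sym≡ (⊕-identityʳ e)) e≦𝟘

subid-⊙ˡ : ∀ {p} e → p ≦ 𝟙 → p ⊙ e ≦ e
subid-⊙ˡ e p≦𝟙 = ≦-trans (⊙-monoˡ e p≦𝟙) (≈⇒≦ (⊙-idˡ e))

subid-⊙ʳ : ∀ {p} e → p ≦ 𝟙 → e ⊙ p ≦ e
subid-⊙ʳ e p≦𝟙 = ≦-trans (⊙-monoʳ e p≦𝟙) (≈⇒≦ (⊙-idʳ e))

⊙≈𝟘-subid : ∀ {p e f} → p ≦ 𝟙 → e ⊙ f ≡ₑ 𝟘 → e ⊙ (p ⊙ f) ≡ₑ 𝟘
⊙≈𝟘-subid {p} {e} {f} p≦𝟙 ef≈𝟘 = ≦𝟘⇒≈𝟘 (begin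
  e ⊙ (p ⊙ f)  ≤⟨ ⊙-monoʳ e (subid-⊙ˡ f p≦𝟙) ⟩
  e ⊙ f        ≈⟨ ef≈𝟘 ⟩
  𝟘            ∎)

⊙≈𝟘-extendʳ : ∀ {e f} g → e ⊙ f ≡ₑ 𝟘 → e ⊙ (f ⊙ g) ≡ₑ 𝟘
⊙≈𝟘-extendʳ {e} {f} g ef≈𝟘 = begin-equality
  e ⊙ (f ⊙ g)  ≈⟨ ⊙-assoc e f g ⟨
  e ⊙ f ⊙ g    ≈⟨ ⊙-cong ef≈𝟘 refl≡ ⟩
  𝟘 ⊙ g        ≈⟨ ⊙-zeroˡ g ⟩
  𝟘            ∎

⊙-absorbˡ : ∀ {p q} e → p ⊕ q ≡ₑ 𝟙 → p ⊙ e ≡ₑ 𝟘 → q ⊙ e ≡ₑ e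
⊙-absorbˡ {p} {q} e p⊕q≈𝟙 pe≈𝟘 = begin-equality
  q ⊙ e          ≈⟨ ⊕-idˡ (q ⊙ e) ⟨
  𝟘 ⊕ q ⊙ e      ≈⟨ ⊕-cong pe≈𝟘 refl≡ ⟨
  p ⊙ e ⊕ q ⊙ e  ≈⟨ distribʳ p q e ⟨
  (p ⊕ q) ⊙ e    ≈⟨ ⊙-cong p⊕q≈𝟙 refl≡ ⟩
  𝟙 ⊙ e          ≈⟨ ⊙-idˡ e ⟩
  e              ∎

⊙-absorbʳ : ∀ {p q} e → p ⊕ q ≡ₑ 𝟙 → e ⊙ q ≡ₑ 𝟘 → e ⊙ p ≡ₑ e
⊙-absorbʳ {p} {q} e p⊕q≈𝟙 eq≈𝟘 = begin-equality
  e ⊙ p          ≈⟨ ⊕-identityʳ (e ⊙ p) ⟨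
  e ⊙ p ⊕ 𝟘      ≈⟨ ⊕-cong refl≡ eq≈𝟘 ⟨
  e ⊙ p ⊕ e ⊙ q  ≈⟨ distribˡ e p q ⟨
  e ⊙ (p ⊕ q)    ≈⟨ ⊙-cong refl≡ p⊕q≈𝟙 ⟩
  e ⊙ 𝟙          ≈⟨ ⊙-idʳ e ⟩
  e              ∎

𝟙≦⋆ : ∀ e → 𝟙 ≦ e ⋆
𝟙≦⋆ e = ≦-trans (e≦e⊕f 𝟙 (e ⊙ e ⋆)) (⋆-unfoldˡ e)

e⊙e⋆≦e⋆ : ∀ e → e ⊙ e ⋆ ≦ e ⋆
e⊙e⋆≦e⋆ e = ≦-trans (f≦e⊕f 𝟙 (e ⊙ e ⋆)) (⋆-unfoldˡ e)

⊥≦𝟙 : ∀ e → e ⊥ᵉ ≦ 𝟙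
⊥≦𝟙 e = ≦-trans (e≦e⊕f (e ⊥ᵉ) (e ⊤ᵉ)) (≈⇒≦ (⊥⊤-compl e))

⊤⊙e≈e : ∀ e → e ⊤ᵉ ⊙ e ≡ₑ e
⊤⊙e≈e e = ⊙-absorbˡ e (⊥⊤-compl e) (⊥-ann e)

⊙⊥-ann : ∀ e f → e ⊙ f ⊥ᵉ ⊙ f ≡ₑ 𝟘
⊙⊥-ann e f = begin-equality
  e ⊙ f ⊥ᵉ ⊙ f    ≈⟨ ⊙-assoc e (f ⊥ᵉ) f ⟩
  e ⊙ (f ⊥ᵉ ⊙ f)  ≈⟨ ⊙-cong refl≡ (⊥-ann f) ⟩
  e ⊙ 𝟘           ≈⟨ ⊙-zeroʳ e ⟩
  𝟘               ∎

⊥≈𝟙⇒≈𝟘 : ∀ {e} → e ⊥ᵉ ≡ₑ 𝟙 → e ≡ₑ 𝟘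
⊥≈𝟙⇒≈𝟘 {e} e⊥≈𝟙 = begin-equality
  e         ≈⟨ ⊙-idˡ e ⟨
  𝟙 ⊙ e     ≈⟨ ⊙-cong e⊥≈𝟙 refl≡ ⟨
  e ⊥ᵉ ⊙ e  ≈⟨ ⊥-ann e ⟩
  𝟘         ∎

𝟙⊥≈𝟘 : 𝟙 ⊥ᵉ ≡ₑ 𝟘
𝟙⊥≈𝟘 = trans≡ (sym≡ (⊙-idʳ (𝟙 ⊥ᵉ))) (⊥-ann 𝟙)

𝟙≦⇒⊥≈𝟘 : ∀ {e} → 𝟙 ≦ e → e ⊥ᵉ ≡ₑ 𝟘
𝟙≦⇒⊥≈𝟘 {e} 𝟙≦e = ≦𝟘⇒≈𝟘 (begin
  e ⊥ᵉ      ≈⟨ ⊙-idʳ (e ⊥ᵉ) ⟨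
  e ⊥ᵉ ⊙ 𝟙  ≤⟨ ⊙-monoʳ (e ⊥ᵉ) 𝟙≦e ⟩
  e ⊥ᵉ ⊙ e  ≈⟨ ⊥-ann e ⟩
  𝟘         ∎)

⊤⊥≈⊥ : ∀ e → e ⊤ᵉ ⊥ᵉ ≡ₑ e ⊥ᵉ
⊤⊥≈⊥ e = begin-equality
  e ⊤ᵉ ⊥ᵉ        ≈⟨ ⊥-cong (⊙-idˡ (e ⊤ᵉ)) ⟨
  (𝟙 ⊙ e ⊤ᵉ) ⊥ᵉ  ≈⟨ ⊥-loc 𝟙 e ⟨
  (𝟙 ⊙ e) ⊥ᵉ     ≈⟨ ⊥-cong (⊙-idˡ e) ⟩
  e ⊥ᵉ           ∎

Test : Expr → Set
Test p = ∃ λ e → p ≡ₑ e ⊥ᵉ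

test-resp : ∀ {p q} → p ≡ₑ q → Test p → Test q
test-resp p≈q (e , p≈e⊥) = e , trans≡ (sym≡ p≈q) p≈e⊥

⊥-test : ∀ e → Test (e ⊥ᵉ)
⊥-test e = e , refl≡

⊤-test : ∀ e → Test (e ⊤ᵉ)
⊤-test e = e ⊥ᵉ , ⊤-def e

𝟘-test : Test 𝟘
𝟘-test = test-resp 𝟙⊥≈𝟘 (⊥-test 𝟙)

test-≦𝟙 : ∀ {p} → Test p → p ≦ 𝟙
test-≦𝟙 (e , p≈e⊥) = ≦-trans (≈⇒≦ p≈e⊥) (⊥≦𝟙 e)

test-⊥⊥ : ∀ {p} → Test p → p ⊥ᵉ ⊥ᵉ ≡ₑ p
test-⊥⊥ {p} (e , p≈e⊥) = begin-equality
  p ⊥ᵉ ⊥ᵉ     ≈⟨ ⊥-cong (⊥-cong p≈e⊥) ⟩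
  e ⊥ᵉ ⊥ᵉ ⊥ᵉ  ≈⟨ ⊥-cong (⊤-def e) ⟨
  e ⊤ᵉ ⊥ᵉ     ≈⟨ ⊤⊥≈⊥ e ⟩
  e ⊥ᵉ        ≈⟨ p≈e⊥ ⟨
  p           ∎

module _ {p : Expr} (p-test : Test p) where

  test-⊤ : p ⊤ᵉ ≡ₑ p
  test-⊤ = trans≡ (⊤-def p) (test-⊥⊥ p-test)

  test-⊙-⊥ : p ⊙ p ⊥ᵉ ≡ₑ 𝟘
  test-⊙-⊥ = trans≡ (⊙-cong (sym≡ (test-⊥⊥ p-test)) refl≡) (⊥-ann (p ⊥ᵉ))

  test-⊕-⊥ : p ⊕ p ⊥ᵉ ≡ₑ 𝟙
  test-⊕-⊥ = begin-equality
    p ⊕ p ⊥ᵉ     ≈⟨ ⊕-comm p (p ⊥ᵉ) ⟩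
    p ⊥ᵉ ⊕ p     ≈⟨ ⊕-cong refl≡ test-⊤ ⟨
    p ⊥ᵉ ⊕ p ⊤ᵉ  ≈⟨ ⊥⊤-compl p ⟩
    𝟙            ∎

  test-idem : p ⊙ p ≡ₑ p
  test-idem = ⊙-absorbʳ p test-⊕-⊥ test-⊙-⊥

  test-comm : ∀ {q} → q ≦ 𝟙 → p ⊙ q ≡ₑ q ⊙ p
  test-comm {q} q≦𝟙 = begin-equality
    p ⊙ q          ≈⟨ ⊙-absorbʳ (p ⊙ q) test-⊕-⊥ pqp⊥≈𝟘 ⟨
    p ⊙ q ⊙ p      ≈⟨ ⊙-assoc p q p ⟩
    p ⊙ (q ⊙ p)    ≈⟨ ⊙-absorbˡ (q ⊙ p) (trans≡ (⊕-comm (p ⊥ᵉ) p) test-⊕-⊥)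
                                        (⊙≈𝟘-subid q≦𝟙 (⊥-ann p)) ⟩
    q ⊙ p          ∎
    where
    pqp⊥≈𝟘 : p ⊙ q ⊙ p ⊥ᵉ ≡ₑ 𝟘
    pqp⊥≈𝟘 = trans≡ (⊙-assoc p q (p ⊥ᵉ)) (⊙≈𝟘-subid q≦𝟙 test-⊙-⊥)

𝟘⊥≈𝟙 : 𝟘 ⊥ᵉ ≡ₑ 𝟙
𝟘⊥≈𝟙 = trans≡ (sym≡ (⊕-idˡ (𝟘 ⊥ᵉ))) (test-⊕-⊥ 𝟘-test)

⊙≈𝟘⇒⊙⊤≈𝟘 : ∀ {e f} → e ⊙ f ≡ₑ 𝟘 → e ⊙ f ⊤ᵉ ≡ₑ 𝟘
⊙≈𝟘⇒⊙⊤≈𝟘 {e} {f} ef≈𝟘 = ⊥≈𝟙⇒≈𝟘 (begin-equality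
  (e ⊙ f ⊤ᵉ) ⊥ᵉ  ≈⟨ ⊥-loc e f ⟨
  (e ⊙ f) ⊥ᵉ     ≈⟨ ⊥-cong ef≈𝟘 ⟩
  𝟘 ⊥ᵉ           ≈⟨ 𝟘⊥≈𝟙 ⟩
  𝟙              ∎)

⊙⊤≈𝟘⇒⊙≈𝟘 : ∀ {e f} → e ⊙ f ⊤ᵉ ≡ₑ 𝟘 → e ⊙ f ≡ₑ 𝟘
⊙⊤≈𝟘⇒⊙≈𝟘 {e} {f} ef⊤≈𝟘 = ⊥≈𝟙⇒≈𝟘 (begin-equality
  (e ⊙ f) ⊥ᵉ     ≈⟨ ⊥-loc e f ⟩
  (e ⊙ f ⊤ᵉ) ⊥ᵉ  ≈⟨ ⊥-cong ef⊤≈𝟘 ⟩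
  𝟘 ⊥ᵉ           ≈⟨ 𝟘⊥≈𝟙 ⟩
  𝟙              ∎)

⋆-⊤ : ∀ e → (e ⋆) ⊤ᵉ ≡ₑ 𝟙
⋆-⊤ e = begin-equality
  e ⋆ ⊤ᵉ     ≈⟨ ⊤-def (e ⋆) ⟩
  e ⋆ ⊥ᵉ ⊥ᵉ  ≈⟨ ⊥-cong (𝟙≦⇒⊥≈𝟘 (𝟙≦⋆ e)) ⟩
  𝟘 ⊥ᵉ       ≈⟨ 𝟘⊥≈𝟙 ⟩
  𝟙          ∎

subid-⊙≈𝟘⇒≦⊥ : ∀ {p e} → p ≦ 𝟙 → p ⊙ e ≡ₑ 𝟘 → p ≦ e ⊥ᵉ
subid-⊙≈𝟘⇒≦⊥ {p} {e} p≦𝟙 pe≈𝟘 = begin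
  p         ≈⟨ ⊙-absorbʳ p (⊥⊤-compl e) (⊙≈𝟘⇒⊙⊤≈𝟘 pe≈𝟘) ⟨
  p ⊙ e ⊥ᵉ  ≤⟨ subid-⊙ˡ (e ⊥ᵉ) p≦𝟙 ⟩
  e ⊥ᵉ      ∎

≦⊥⇒⊙≈𝟘 : ∀ {p e} → p ≦ e ⊥ᵉ → p ⊙ e ≡ₑ 𝟘
≦⊥⇒⊙≈𝟘 {p} {e} p≦e⊥ = ≦𝟘⇒≈𝟘 (begin
  p ⊙ e     ≤⟨ ⊙-monoˡ e p≦e⊥ ⟩
  e ⊥ᵉ ⊙ e  ≈⟨ ⊥-ann e ⟩
  𝟘         ∎)

test-⊙≈𝟘⇔≦⊥ : ∀ {p e} → Test p → (p ⊙ e ≡ₑ 𝟘) ⇔ (p ≦ e ⊥ᵉ)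
test-⊙≈𝟘⇔≦⊥ p-test = mk⇔ (subid-⊙≈𝟘⇒≦⊥ (test-≦𝟙 p-test)) ≦⊥⇒⊙≈𝟘

⊥-unique : ∀ {p e} → p ≦ 𝟙 → p ⊕ e ≡ₑ 𝟙 → p ⊙ e ≡ₑ 𝟘 → e ⊥ᵉ ≡ₑ p
⊥-unique {p} {e} p≦𝟙 p⊕e≈𝟙 pe≈𝟘 = ≦-antisym e⊥≦p (subid-⊙≈𝟘⇒≦⊥ p≦𝟙 pe≈𝟘)
  where
  e⊥≦p : e ⊥ᵉ ≦ p
  e⊥≦p = begin
    e ⊥ᵉ      ≈⟨ ⊙-absorbʳ (e ⊥ᵉ) p⊕e≈𝟙 (⊥-ann e) ⟨
    e ⊥ᵉ ⊙ p  ≤⟨ subid-⊙ˡ p (⊥≦𝟙 e) ⟩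
    p         ∎

⊥-⊕ : ∀ e f → (e ⊕ f) ⊥ᵉ ≡ₑ e ⊥ᵉ ⊙ f ⊥ᵉ
⊥-⊕ e f = ≦-antisym ≦e⊥f⊥ (subid-⊙≈𝟘⇒≦⊥ e⊥f⊥≦𝟙 e⊥f⊥-ann)
  where
  s : Expr
  s = (e ⊕ f) ⊥ᵉ

  s-ann : ∀ {g} → g ≦ e ⊕ f → s ⊙ g ≡ₑ 𝟘
  s-ann {g} g≦e⊕f = ≦𝟘⇒≈𝟘 (≦-trans (⊙-monoʳ s g≦e⊕f) (≈⇒≦ (⊥-ann (e ⊕ f))))

  ≦e⊥f⊥ : s ≦ e ⊥ᵉ ⊙ f ⊥ᵉ
  ≦e⊥f⊥ = begin
    s             ≈⟨ test-idem (⊥-test (e ⊕ f)) ⟨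
    s ⊙ s         ≤⟨ ⊙-mono (subid-⊙≈𝟘⇒≦⊥ (⊥≦𝟙 (e ⊕ f)) (s-ann (e≦e⊕f e f)))
                            (subid-⊙≈𝟘⇒≦⊥ (⊥≦𝟙 (e ⊕ f)) (s-ann (f≦e⊕f e f))) ⟩
    e ⊥ᵉ ⊙ f ⊥ᵉ  ∎

  e⊥f⊥≦𝟙 : e ⊥ᵉ ⊙ f ⊥ᵉ ≦ 𝟙
  e⊥f⊥≦𝟙 = ≦-trans (subid-⊙ˡ (f ⊥ᵉ) (⊥≦𝟙 e)) (⊥≦𝟙 f)

  e⊥f⊥-ann : e ⊥ᵉ ⊙ f ⊥ᵉ ⊙ (e ⊕ f) ≡ₑ 𝟘
  e⊥f⊥-ann = begin-equality
    e ⊥ᵉ ⊙ f ⊥ᵉ ⊙ (e ⊕ f)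
      ≈⟨ distribˡ (e ⊥ᵉ ⊙ f ⊥ᵉ) e f ⟩
    e ⊥ᵉ ⊙ f ⊥ᵉ ⊙ e ⊕ e ⊥ᵉ ⊙ f ⊥ᵉ ⊙ f
      ≈⟨ ⊕-cong (⊙-cong (test-comm (⊥-test e) (⊥≦𝟙 f)) refl≡) (⊙⊥-ann (e ⊥ᵉ) f) ⟩
    f ⊥ᵉ ⊙ e ⊥ᵉ ⊙ e ⊕ 𝟘
      ≈⟨ ⊕-cong (⊙⊥-ann (f ⊥ᵉ) e) refl≡ ⟩
    𝟘 ⊕ 𝟘
      ≈⟨ ⊕-idem 𝟘 ⟩
    𝟘 ∎

test-⊙ : ∀ {p q} → Test p → Test q → Test (p ⊙ q)
test-⊙ (e , p≈e⊥) (f , q≈f⊥) = e ⊕ f , trans≡ (⊙-cong p≈e⊥ q≈f⊥) (sym≡ (⊥-⊕ e f))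

test-deMorgan : ∀ {p q} → Test p → Test q → (p ⊥ᵉ ⊙ q ⊥ᵉ) ⊥ᵉ ≡ₑ p ⊕ q
test-deMorgan {p} {q} p-test q-test =
  ⊥-unique (⊕-lub (test-≦𝟙 p-test) (test-≦𝟙 q-test)) sum≈𝟙 product≈𝟘
  where
  r : Expr
  r = p ⊥ᵉ ⊙ q ⊥ᵉ

  r≈q⊥p⊥ : r ≡ₑ q ⊥ᵉ ⊙ p ⊥ᵉ
  r≈q⊥p⊥ = test-comm (⊥-test p) (⊥≦𝟙 q)

  r≦𝟙 : r ≦ 𝟙
  r≦𝟙 = ≦-trans (subid-⊙ˡ (q ⊥ᵉ) (⊥≦𝟙 p)) (⊥≦𝟙 q)

  𝟙≦sum : 𝟙 ≦ p ⊕ q ⊕ r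
  𝟙≦sum = begin
    𝟙                             ≈⟨ test-⊕-⊥ p-test ⟨
    p ⊕ p ⊥ᵉ                      ≈⟨ ⊕-cong refl≡ (⊙-idʳ (p ⊥ᵉ)) ⟨
    p ⊕ p ⊥ᵉ ⊙ 𝟙                  ≈⟨ ⊕-cong refl≡ (⊙-cong refl≡ (test-⊕-⊥ q-test)) ⟨
    p ⊕ p ⊥ᵉ ⊙ (q ⊕ q ⊥ᵉ)         ≈⟨ ⊕-cong refl≡ (distribˡ (p ⊥ᵉ) q (q ⊥ᵉ)) ⟩
    p ⊕ (p ⊥ᵉ ⊙ q ⊕ r)            ≤⟨ ⊕-monoʳ p (⊕-lub p⊥q≦q⊕r (f≦e⊕f q r)) ⟩
    p ⊕ (q ⊕ r)                   ≈⟨ ⊕-assoc p q r ⟨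
    p ⊕ q ⊕ r                     ∎
    where
    p⊥q≦q⊕r : p ⊥ᵉ ⊙ q ≦ q ⊕ r
    p⊥q≦q⊕r = ≦-trans (subid-⊙ˡ q (⊥≦𝟙 p)) (e≦e⊕f q r)

  sum≈𝟙 : p ⊕ q ⊕ r ≡ₑ 𝟙
  sum≈𝟙 = ≦-antisym (⊕-lub (⊕-lub (test-≦𝟙 p-test) (test-≦𝟙 q-test)) r≦𝟙) 𝟙≦sum

  product≈𝟘 : (p ⊕ q) ⊙ r ≡ₑ 𝟘
  product≈𝟘 = begin-equality
    (p ⊕ q) ⊙ r                  ≈⟨ distribʳ p q r ⟩
    p ⊙ r ⊕ q ⊙ r                ≈⟨ ⊕-cong refl≡ (⊙-cong refl≡ r≈q⊥p⊥) ⟩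
    p ⊙ r ⊕ q ⊙ (q ⊥ᵉ ⊙ p ⊥ᵉ)    ≈⟨ ⊕-cong (⊙≈𝟘-extendʳ (q ⊥ᵉ) (test-⊙-⊥ p-test))
                                           (⊙≈𝟘-extendʳ (p ⊥ᵉ) (test-⊙-⊥ q-test)) ⟩
    𝟘 ⊕ 𝟘                        ≈⟨ ⊕-idem 𝟘 ⟩
    𝟘                            ∎

test-⊕ : ∀ {p q} → Test p → Test q → Test (p ⊕ q)
test-⊕ {p} {q} p-test q-test = p ⊥ᵉ ⊙ q ⊥ᵉ , sym≡ (test-deMorgan p-test q-test)

⊤-⊕ : ∀ e f → (e ⊕ f) ⊤ᵉ ≡ₑ e ⊤ᵉ ⊕ f ⊤ᵉ
⊤-⊕ e f = begin-equality
  (e ⊕ f) ⊤ᵉ                 ≈⟨ ⊤-def (e ⊕ f) ⟩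
  (e ⊕ f) ⊥ᵉ ⊥ᵉ              ≈⟨ ⊥-cong (⊥-⊕ e f) ⟩
  (e ⊥ᵉ ⊙ f ⊥ᵉ) ⊥ᵉ           ≈⟨ ⊥-cong (⊙-cong (⊤⊥≈⊥ e) (⊤⊥≈⊥ f)) ⟨
  (e ⊤ᵉ ⊥ᵉ ⊙ f ⊤ᵉ ⊥ᵉ) ⊥ᵉ     ≈⟨ test-deMorgan (⊤-test e) (⊤-test f) ⟩
  e ⊤ᵉ ⊕ f ⊤ᵉ                ∎

test-⊤-⊙ : ∀ {p} f → Test p → (p ⊙ f) ⊤ᵉ ≡ₑ p ⊙ f ⊤ᵉ
test-⊤-⊙ {p} f p-test = begin-equality
  (p ⊙ f) ⊤ᵉ           ≈⟨ ⊤-def (p ⊙ f) ⟩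
  (p ⊙ f) ⊥ᵉ ⊥ᵉ        ≈⟨ ⊥-cong (⊥-loc p f) ⟩
  (p ⊙ f ⊤ᵉ) ⊥ᵉ ⊥ᵉ     ≈⟨ test-⊥⊥ (test-⊙ p-test (⊤-test f)) ⟩
  p ⊙ f ⊤ᵉ             ∎

⊤≦test⇔⊥⊙≈𝟘 : ∀ {p} e → Test p → (e ⊤ᵉ ≦ p) ⇔ (p ⊥ᵉ ⊙ e ≡ₑ 𝟘)
⊤≦test⇔⊥⊙≈𝟘 {p} e p-test = mk⇔ to from
  where
  to : e ⊤ᵉ ≦ p → p ⊥ᵉ ⊙ e ≡ₑ 𝟘
  to e⊤≦p = ⊙⊤≈𝟘⇒⊙≈𝟘 (≦𝟘⇒≈𝟘 (begin
    p ⊥ᵉ ⊙ e ⊤ᵉ  ≤⟨ ⊙-monoʳ (p ⊥ᵉ) e⊤≦p ⟩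
    p ⊥ᵉ ⊙ p     ≈⟨ ⊥-ann p ⟩
    𝟘            ∎))

  from : p ⊥ᵉ ⊙ e ≡ₑ 𝟘 → e ⊤ᵉ ≦ p
  from p⊥e≈𝟘 = begin
    e ⊤ᵉ      ≈⟨ ⊙-absorbˡ (e ⊤ᵉ) (trans≡ (⊕-comm (p ⊥ᵉ) p) (test-⊕-⊥ p-test))
                                   (⊙≈𝟘⇒⊙⊤≈𝟘 p⊥e≈𝟘) ⟨
    p ⊙ e ⊤ᵉ  ≤⟨ subid-⊙ʳ p (test-≦𝟙 (⊤-test e)) ⟩
    p         ∎

⋆-invariant : ∀ {t} e → Test t → t ⊥ᵉ ⊙ (e ⊙ t) ≡ₑ 𝟘 → t ⊥ᵉ ⊙ (e ⋆ ⊙ t) ≡ₑ 𝟘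
⋆-invariant {t} e t-test t⊥et≈𝟘 = ≦𝟘⇒≈𝟘 (begin
  t ⊥ᵉ ⊙ (e ⋆ ⊙ t)  ≤⟨ ⊙-monoʳ (t ⊥ᵉ) (⋆-indˡ (⊕-lub t≦G eG≦G)) ⟩
  t ⊥ᵉ ⊙ G          ≈⟨ ⊙≈𝟘-extendʳ (e ⋆ ⊙ t) (⊥-ann t) ⟩
  𝟘                 ∎)
  where
  G : Expr
  G = t ⊙ (e ⋆ ⊙ t)

  t≦𝟙 : t ≦ 𝟙
  t≦𝟙 = test-≦𝟙 t-test

  et≈tet : e ⊙ t ≡ₑ t ⊙ (e ⊙ t)
  et≈tet = sym≡ (⊙-absorbˡ (e ⊙ t) (trans≡ (⊕-comm (t ⊥ᵉ) t) (test-⊕-⊥ t-test)) t⊥et≈𝟘)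

  t≦G : t ≦ G
  t≦G = begin
    t            ≈⟨ test-idem t-test ⟨
    t ⊙ t        ≈⟨ ⊙-cong refl≡ (⊙-idˡ t) ⟨
    t ⊙ (𝟙 ⊙ t)  ≤⟨ ⊙-monoʳ t (⊙-monoˡ t (𝟙≦⋆ e)) ⟩
    G            ∎

  eG≦G : e ⊙ G ≦ G
  eG≦G = begin
    e ⊙ G                          ≈⟨ ⊙-assoc e t (e ⋆ ⊙ t) ⟨
    e ⊙ t ⊙ (e ⋆ ⊙ t)              ≈⟨ ⊙-cong et≈tet refl≡ ⟩
    t ⊙ (e ⊙ t) ⊙ (e ⋆ ⊙ t)        ≈⟨ trans≡ (⊙-assoc t (e ⊙ t) (e ⋆ ⊙ t))
                                            (⊙-cong refl≡ (⊙-assoc e t (e ⋆ ⊙ t))) ⟩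
    t ⊙ (e ⊙ G)                    ≤⟨ ⊙-monoʳ t (⊙-monoʳ e (subid-⊙ˡ (e ⋆ ⊙ t) t≦𝟙)) ⟩
    t ⊙ (e ⊙ (e ⋆ ⊙ t))            ≈⟨ ⊙-cong refl≡ (⊙-assoc e (e ⋆) t) ⟨
    t ⊙ (e ⊙ e ⋆ ⊙ t)              ≤⟨ ⊙-monoʳ t (⊙-monoˡ t (e⊙e⋆≦e⋆ e)) ⟩
    G                              ∎

test-⊤-⋆-induction : ∀ {p} e → Test p → (e ⊙ p) ⊤ᵉ ≦ p → (e ⋆ ⊙ p) ⊤ᵉ ≦ p
test-⊤-⋆-induction e p-test e⊙p⊤≦p =
  Equivalence.from (⊤≦test⇔⊥⊙≈𝟘 _ p-test)
    (⋆-invariant e p-test (Equivalence.to (⊤≦test⇔⊥⊙≈𝟘 _ p-test) e⊙p⊤≦p))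

test-⊥-⋆-induction : ∀ {p} e → Test p → p ≦ (e ⊙ p ⊥ᵉ) ⊥ᵉ → p ≦ (e ⋆ ⊙ p ⊥ᵉ) ⊥ᵉ
test-⊥-⋆-induction {p} e p-test p≦ep⊥⊥ =
  Equivalence.to (test-⊙≈𝟘⇔≦⊥ p-test)
    (trans≡ (⊙-cong (sym≡ (test-⊥⊥ p-test)) refl≡)
      (⋆-invariant e (⊥-test p)
        (trans≡ (⊙-cong (test-⊥⊥ p-test) refl≡)
          (Equivalence.from (test-⊙≈𝟘⇔≦⊥ p-test) p≦ep⊥⊥))))

formula-test : ∀ φ → Test ⌜ φ ⌝
formula-test (fprop n) = test-resp (prop-⊤ n) (⊤-test (prop n))
formula-test f𝟘 = 𝟘-test
formula-test f𝟙 = test-resp 𝟘⊥≈𝟙 (⊥-test 𝟘)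
formula-test (φ f⊕ ψ) = test-⊕ (formula-test φ) (formula-test ψ)
formula-test (φ f⊙ ψ) = test-⊙ (formula-test φ) (formula-test ψ)
formula-test (e f⊥) = ⊥-test e
formula-test (e f⊤) = ⊤-test e

proposition1 : (∀ e → (e ⊥ᵉ) ⊤ᵉ ≡ₑ e ⊥ᵉ)
    × (𝟙 ⊥ᵉ ≡ₑ 𝟘)
    × (𝟘 ⊥ᵉ ≡ₑ 𝟙)
    × (∀ e f → (e ⊕ f) ⊤ᵉ ≡ₑ e ⊤ᵉ ⊕ f ⊤ᵉ)
    × (∀ e f → (e ⊤ᵉ ⊙ f) ⊤ᵉ ≡ₑ e ⊤ᵉ ⊙ f ⊤ᵉ)
    × (∀ e → e ⊤ᵉ ⊙ e ≡ₑ e)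
    × (∀ e → (e ⋆) ⊤ᵉ ≡ₑ 𝟙)
    × (∀ e f → (e ⊙ f ⊤ᵉ ≡ₑ 𝟘) ⇔ (e ⊙ f ≡ₑ 𝟘))
    × (∀ φ → ⌜ φ ⌝ ⊙ ⌜ φ ⌝ ⊥ᵉ ≡ₑ 𝟘)
    × (∀ φ → ⌜ φ ⌝ ⊕ ⌜ φ ⌝ ⊥ᵉ ≡ₑ 𝟙)
    × (∀ φ → (⌜ φ ⌝ ⊥ᵉ) ⊥ᵉ ≡ₑ ⌜ φ ⌝)
    × (∀ φ e → (⌜ φ ⌝ ⊙ e ≡ₑ 𝟘) ⇔ (⌜ φ ⌝ ≦ e ⊥ᵉ))
    × (∀ φ → ⌜ φ ⌝ ⊙ ⌜ φ ⌝ ≡ₑ ⌜ φ ⌝)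
    × (∀ φ ψ → ⌜ φ ⌝ ⊙ ⌜ ψ ⌝ ≡ₑ ⌜ ψ ⌝ ⊙ ⌜ φ ⌝)
    × (∀ φ → ⌜ φ ⌝ ⊤ᵉ ≡ₑ ⌜ φ ⌝)
    × (∀ e φ → (e ⊙ ⌜ φ ⌝) ⊤ᵉ ≦ ⌜ φ ⌝ → (e ⋆ ⊙ ⌜ φ ⌝) ⊤ᵉ ≦ ⌜ φ ⌝)
    × (∀ e φ → ⌜ φ ⌝ ≦ (e ⊙ ⌜ φ ⌝ ⊥ᵉ) ⊥ᵉ → ⌜ φ ⌝ ≦ (e ⋆ ⊙ ⌜ φ ⌝ ⊥ᵉ) ⊥ᵉ)
proposition1 =
    (λ e → test-⊤ (⊥-test e))
  , 𝟙⊥≈𝟘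
  , 𝟘⊥≈𝟙
  , ⊤-⊕
  , (λ e f → test-⊤-⊙ f (⊤-test e))
  , ⊤⊙e≈e
  , ⋆-⊤
  , (λ e f → mk⇔ ⊙⊤≈𝟘⇒⊙≈𝟘 ⊙≈𝟘⇒⊙⊤≈𝟘)
  , (λ φ → test-⊙-⊥ (formula-test φ))
  , (λ φ → test-⊕-⊥ (formula-test φ))
  , (λ φ → test-⊥⊥ (formula-test φ))
  , (λ φ e → test-⊙≈𝟘⇔≦⊥ (formula-test φ))
  , (λ φ → test-idem (formula-test φ))
  , (λ φ ψ → test-comm (formula-test φ) (test-≦𝟙 (formula-test ψ)))
  , (λ φ → test-⊤ (formula-test φ))
  , (λ e φ → test-⊤-⋆-induction e (formula-test φ))
  , (λ e φ → test-⊥-⋆-induction e (formula-test φ))
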